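{- Every instance of the axiom schemes (A0)–(A9) of $\Sigma$ is valid over the class of normal jstit models (true at every moment-history pair of every normal jstit model), and every application of any of the rules (R1)–(R4) to formulas valid over the class of normal jstit models yields a formula valid over the class of normal jstit models.
   Context: Fix a finite nonempty set $Ag$ of agents and countably infinite, pairwise disjoint sets $PVar$ (proof variables), $PConst$ (proof constants) and $Var$ (propositional variables). Proof polynomials: $t ::= x \mid c \mid s+t \mid s\times t \mid\ !t$; their set is $Pol$. Formulas: $A ::= p \mid A\wedge B \mid \neg A \mid [j]A \mid \Box A \mid t{:}A \mid KA \mid Et$ ($p\in Var$, $j\in Ag$, $t\in Pol$); their set is $Form$; $\Diamond=\neg\Box\neg$. A jstit model is $\mathcal{M}=\langle Tree,\unlhd,Choice,Act,R,R_e,\mathcal{E},V\rangle$ where $Tree\neq\emptyset$; $\unlhd$ is a partial order on $Tree$ ($\lhd$ its strict part); histories are maximal $\unlhd$-chains, $H_m$ the histories containing $m$, $MH=\{(m,h): h\in H_m\}$; $Choice^m_j$ ($j\in Ag$) is a partition of $H_m$, $Choice^m_j(h)$ the cell of $h$; $Act: MH\to 2^{Pol}$; $R\subseteq R_e$ are preorders on $Tree$; $\mathcal{E}:Tree\times Pol\to 2^{Form}$; $V:Var\to 2^{MH}$. Constraints: (1) any two moments have a common $\unlhd$-lower bound; (2) $m_1\unlhd m$, $m_2\unlhd m$ imply $m_1\unlhd m_2$ or $m_2\unlhd m_1$; (3) if $h,h'\in H_m$ and some $m'\rhd m$ lies in $h\cap h'$ then $Choice^m_j(h)=Choice^m_j(h')$;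 (4) for every $m$ and cells $f(j)\in Choice^m_j$, $\bigcap_j f(j)\neq\emptyset$; (5) $R_e(m,m')$ implies $\mathcal{E}(m,t)\subseteq\mathcal{E}(m',t)$; (6) $A\to B\in\mathcal{E}(m,s)$, $A\in\mathcal{E}(m,t)$ imply $B\in\mathcal{E}(m,s\times t)$; $\mathcal{E}(m,s)\cup\mathcal{E}(m,t)\subseteq\mathcal{E}(m,s+t)$; $A\in\mathcal{E}(m,t)$ implies $t{:}A\in\mathcal{E}(m,!t)$; (7) $m'\lhd m$, $h\in H_m$ imply $Act(m',h)\subseteq Act(m,h)$; (8) $\bigcap_{h\in H_m}Act(m,h)\subseteq\bigcup_{m'\lhd m,\,h\in H_m}Act(m',h)$; (9) if $h,h'\in H_m$ and some $m'\rhd m$ lies in $h\cap h'$ then $Act(m,h)=Act(m,h')$; (10) $\unlhd\subseteq R$; (11) $R_e(m,m')$ implies $\bigcap_{h\in H_m}Act(m,h)\subseteq\bigcap_{h'\in H_{m'}}Act(m',h')$. Truth at $(m,h)$: $p$ iff $(m,h)\in V(p)$; Booleans standard; $[j]A$ iff $A$ at $(m,h')$ for all $h'\in Choice^m_j(h)$; $\Box A$ iff $A$ at $(m,h')$ for all $h'\in H_m$; $KA$ iff $A$ at all $(m',h')$ with $R(m,m')$, $h'\in H_{m'}$; $t{:}A$ iff $A\in\mathcal{E}(m,t)$ and $A$ at all $(m',h')$ with $R_e(m,m')$, $h'\in H_{m'}$; $Et$ iff $t\in Act(m,h)$. A jstit model is normal if for every $c\in PConst$ and $m\in Tree$, every instance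 of (A0)–(A9) belongs to $\mathcal{E}(m,c)$. Axiom schemes: (A0) propositional tautologies; (A1) S5 axioms for $\Box$ and each $[j]$; (A2) $\Box A\to[j]A$; (A3) $(\Diamond[j_1]A_1\wedge\dots\wedge\Diamond[j_n]A_n)\to\Diamond([j_1]A_1\wedge\dots\wedge[j_n]A_n)$, $j_i$ pairwise distinct; (A4) $s{:}(A\to B)\to(t{:}A\to(s\times t){:}B)$; (A5) $t{:}A\to(!t{:}(t{:}A)\wedge KA)$; (A6) $(s{:}A\vee t{:}A)\to(s+t){:}A$; (A7) S4 axioms for $K$; (A8) $KA\to\Box K\Box A$; (A9) $\Box Et\to K\Box Et$. Rules: (R1) from $A$ and $A\to B$ infer $B$; (R2) from $A$ infer $KA$; (R3) if $A$ is an instance of (A0)–(A9) and $c\in PConst$, infer $c{:}A$; (R4) from $KA\to(\neg\Box Et_1\vee\dots\vee\neg\Box Et_n)$ infer $KA\to(\neg Et_1\vee\dots\vee\neg Et_n)$. -}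

module Defs where

open import Level using (Level; 0ℓ; Lift) renaming (suc to lsuc)
open import Data.Nat using (ℕ)
import Data.Bool as B
open B using (Bool; true)
open import Data.List using (List; []; _∷_; map)
open import Data.Product using (Σ; _×_; _,_; proj₁; proj₂)
open import Data.Sum using (_⊎_)
open import Relation.Nullary using (¬_)
open import Relation.Binary.PropositionalEquality using (_≡_; _≢_)
open import Relation.Binary.Structures using (IsPartialOrder; IsPreorder)
open import Data.List.Relation.Unary.Unique.Propositional using (Unique)

module _ {T : Set} (_⊴_ : T → T → Set) where

  Strict : T → T → Set
  Strict x y = (x ⊴ y) × (x ≢ y)

  Chain : (T → Set) → Set
  Chain h = ∀ x y → h x → h y → (x ⊴ y) ⊎ (y ⊴ x)

  MaxChain : (T → Set) → Set₁
  MaxChain h = Chain h × (∀ h' → Chain h' → (∀ x → h x → h' x) → ∀ x → h' x → h x)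

  Hist : T → (T → Set) → Set₁
  Hist m h = MaxChain h × h m

_≐_ : {T : Set} → (T → Set) → (T → Set) → Set
h ≐ h' = (∀ x → h x → h' x) × (∀ x → h' x → h x)

module J (Ag : Set) where

  infixl 7 _⊕_ _⊗_
  infix 8 !_

  data Pol : Set where
    pvar   : ℕ → Pol
    pconst : ℕ → Pol
    _⊕_    : Pol → Pol → Pol
    _⊗_    : Pol → Pol → Pol
    !_     : Pol → Pol

  infixr 4 _⇒_
  infixr 5 _∨_
  infixr 6 _∧_
  infix 7 ∼_ □_ ◇_ K_ E_ [_]_ _∶_

  data Form : Set where
    var  : ℕ → Form
    _∧_  : Form → Form → Form
    ∼_   : Form → Form
    [_]_ : Ag → Form → Form
    □_   : Form → Form
    _∶_  : Pol → Form → Form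
    K_   : Form → Form
    E_   : Pol → Form

  _⇒_ : Form → Form → Form
  A ⇒ B = ∼ (A ∧ ∼ B)

  _∨_ : Form → Form → Form
  A ∨ B = ∼ (∼ A ∧ ∼ B)

  ◇_ : Form → Form
  ◇ A = ∼ □ ∼ A

  ⋀ : Form → List Form → Form
  ⋀ A [] = A
  ⋀ A (B ∷ Bs) = A ∧ ⋀ B Bs

  ⋁ : Form → List Form → Form
  ⋁ A [] = A
  ⋁ A (B ∷ Bs) = A ∨ ⋁ B Bs

  -- propositional tautologies: true under every Boolean valuation of the
  -- maximal non-Boolean subformulas
  evalB : (Form → Bool) → Form → Bool
  evalB v (A ∧ B) = evalB v A B.∧ evalB v B
  evalB v (∼ A)   = B.not (evalB v A)
  evalB v A       = v A

  Tautology : Form → Set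
  Tautology A = ∀ (v : Form → Bool) → evalB v A ≡ true

  data Axiom : Form → Set where
    A0   : ∀ {A} → Tautology A → Axiom A
    A1□K : ∀ A B → Axiom (□ (A ⇒ B) ⇒ (□ A ⇒ □ B))
    A1□T : ∀ A → Axiom (□ A ⇒ A)
    A1□4 : ∀ A → Axiom (□ A ⇒ □ □ A)
    A1□B : ∀ A → Axiom (A ⇒ □ ◇ A)
    A1□5 : ∀ A → Axiom (◇ A ⇒ □ ◇ A)
    A1jK : ∀ j A B → Axiom ([ j ] (A ⇒ B) ⇒ ([ j ] A ⇒ [ j ] B))
    A1jT : ∀ j A → Axiom ([ j ] A ⇒ A)
    A1j4 : ∀ j A → Axiom ([ j ] A ⇒ [ j ] [ j ] A)
    A1jB : ∀ j A → Axiom (A ⇒ [ j ] ∼ [ j ] ∼ A)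
    A1j5 : ∀ j A → Axiom (∼ [ j ] ∼ A ⇒ [ j ] ∼ [ j ] ∼ A)
    A2   : ∀ j A → Axiom (□ A ⇒ [ j ] A)
    A3   : ∀ (j : Ag) (A : Form) (js : List (Ag × Form)) →
           Unique (map proj₁ ((j , A) ∷ js)) →
           Axiom (⋀ (◇ [ j ] A) (map (λ p → ◇ [ proj₁ p ] proj₂ p) js)
                  ⇒ ◇ (⋀ ([ j ] A) (map (λ p → [ proj₁ p ] proj₂ p) js)))
    A4   : ∀ s t A B → Axiom ((s ∶ (A ⇒ B)) ⇒ ((t ∶ A) ⇒ ((s ⊗ t) ∶ B)))
    A5   : ∀ t A → Axiom ((t ∶ A) ⇒ ((! t ∶ (t ∶ A)) ∧ K A))
    A6   : ∀ s t A → Axiom (((s ∶ A) ∨ (t ∶ A)) ⇒ ((s ⊕ t) ∶ A))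
    A7K  : ∀ A B → Axiom (K (A ⇒ B) ⇒ (K A ⇒ K B))
    A7T  : ∀ A → Axiom (K A ⇒ A)
    A74  : ∀ A → Axiom (K A ⇒ K K A)
    A8   : ∀ A → Axiom (K A ⇒ □ K □ A)
    A9   : ∀ t → Axiom (□ E t ⇒ K □ E t)

  -- Histories are maximal chains, represented as predicates
  -- on Tree; Choice^m_j is given as an equivalence relation on H_m (its
  -- classes are the cells); Act, 𝓔, V are given as membership predicates.
  record Model : Set₁ where
    field
      Tree      : Set
      tree-ne   : Tree
      _⊴_       : Tree → Tree → Set
      ⊴-po      : IsPartialOrder _≡_ _⊴_
      lower     : ∀ m m' → Σ Tree λ m'' → (m'' ⊴ m) × (m'' ⊴ m')
      back-lin  : ∀ m m₁ m₂ → m₁ ⊴ m → m₂ ⊴ m → (m₁ ⊴ m₂) ⊎ (m₂ ⊴ m₁)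

      Choice    : Tree → Ag → (Tree → Set) → (Tree → Set) → Set
      ch-refl   : ∀ m j h → Hist _⊴_ m h → Choice m j h h
      ch-sym    : ∀ m j h h' → Hist _⊴_ m h → Hist _⊴_ m h' →
                  Choice m j h h' → Choice m j h' h
      ch-trans  : ∀ m j h h' h'' → Hist _⊴_ m h → Hist _⊴_ m h' → Hist _⊴_ m h'' →
                  Choice m j h h' → Choice m j h' h'' → Choice m j h h''
      ch-ext    : ∀ m j h₁ h₂ h₁' h₂' → h₁ ≐ h₁' → h₂ ≐ h₂' →
                  Choice m j h₁ h₂ → Choice m j h₁' h₂'
      no-choice : ∀ m j h h' m' → Hist _⊴_ m h → Hist _⊴_ m h' →
                  Strict _⊴_ m m' → h m' → h' m' → Choice m j h h'
      indep     : ∀ m (f : Ag → Tree → Set) → (∀ j → Hist _⊴_ m (f j)) →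
                  Σ (Tree → Set) λ h → Hist _⊴_ m h × (∀ j → Choice m j (f j) h)

      Act       : Tree → (Tree → Set) → Pol → Set
      act-ext   : ∀ m h h' t → h ≐ h' → Act m h t → Act m h' t
      act-mono  : ∀ m' m h t → Strict _⊴_ m' m → Hist _⊴_ m h → Act m' h t → Act m h t
      act-past  : ∀ m t → (∀ h → Hist _⊴_ m h → Act m h t) →
                  Σ Tree λ m' → Σ (Tree → Set) λ h →
                    Strict _⊴_ m' m × Hist _⊴_ m h × Act m' h t
      act-nbc   : ∀ m h h' m' t → Hist _⊴_ m h → Hist _⊴_ m h' →
                  Strict _⊴_ m m' → h m' → h' m' → Act m h t → Act m h' t

      R         : Tree → Tree → Set
      Re        : Tree → Tree → Set
      R-pre     : IsPreorder _≡_ R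
      Re-pre    : IsPreorder _≡_ Re
      R⊆Re      : ∀ m m' → R m m' → Re m m'
      ⊴⊆R       : ∀ m m' → m ⊴ m' → R m m'
      act-Re    : ∀ m m' t → Re m m' → (∀ h → Hist _⊴_ m h → Act m h t) →
                  ∀ h' → Hist _⊴_ m' h' → Act m' h' t

      𝓔         : Tree → Pol → Form → Set
      𝓔-mono    : ∀ m m' t A → Re m m' → 𝓔 m t A → 𝓔 m' t A
      𝓔-app     : ∀ m s t A B → 𝓔 m s (A ⇒ B) → 𝓔 m t A → 𝓔 m (s ⊗ t) B
      𝓔-sumˡ    : ∀ m s t A → 𝓔 m s A → 𝓔 m (s ⊕ t) A
      𝓔-sumʳ    : ∀ m s t A → 𝓔 m t A → 𝓔 m (s ⊕ t) A
      𝓔-bang    : ∀ m t A → 𝓔 m t A → 𝓔 m (! t) (t ∶ A)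

      V         : ℕ → Tree → (Tree → Set) → Set
      V-ext     : ∀ p m h h' → h ≐ h' → V p m h → V p m h'

  open Model public

  _,_,_⊨_ : (M : Model) → Tree M → (Tree M → Set) → Form → Set₁
  M , m , h ⊨ var p   = Lift (lsuc 0ℓ) (V M p m h)
  M , m , h ⊨ (A ∧ B) = (M , m , h ⊨ A) × (M , m , h ⊨ B)
  M , m , h ⊨ (∼ A)   = ¬ (M , m , h ⊨ A)
  M , m , h ⊨ ([ j ] A) = ∀ h' → Hist (_⊴_ M) m h' → Choice M m j h h' → M , m , h' ⊨ A
  M , m , h ⊨ (□ A)   = ∀ h' → Hist (_⊴_ M) m h' → M , m , h' ⊨ A
  M , m , h ⊨ (K A)   = ∀ m' h' → R M m m' → Hist (_⊴_ M) m' h' → M , m' , h' ⊨ A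
  M , m , h ⊨ (t ∶ A) = Lift (lsuc 0ℓ) (𝓔 M m t A) ×
                        (∀ m' h' → Re M m m' → Hist (_⊴_ M) m' h' → M , m' , h' ⊨ A)
  M , m , h ⊨ (E t)   = Lift (lsuc 0ℓ) (Act M m h t)

  Normal : Model → Set
  Normal M = ∀ (c : ℕ) (m : Tree M) (A : Form) → Axiom A → 𝓔 M m (pconst c) A

  Valid : Form → Set₁
  Valid A = ∀ (M : Model) → Normal M → ∀ (m : Tree M) (h : Tree M → Set) →
            Hist (_⊴_ M) m h → M , m , h ⊨ A

-- Soundness is checked clause by clause against the semantics, reasoning
-- classically in the metatheory.  Most axioms hold by the order-theoretic
-- properties of the accessibility relations and the closure conditions on
-- the evidence function.  (A3) holds because the independence condition (4)
-- lets us combine, in one history, the choice cells witnessing each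
-- ◇[jᵢ]Aᵢ.  Rule (R4) is the one place where the tree structure matters: a
-- history h through m either continues to a later moment m', at which
-- everything done at (m,h) is settled (constraints (9) and (7)), or h is the
-- only history through m; in both cases Et at (m,h) becomes □Et at a moment
-- R-accessible from m.

module Submission where

open import Defs
open import Level using (0ℓ; lift) renaming (suc to lsuc)
open import Function using (_∘_)
open import Data.Nat using (ℕ; suc)
open import Data.Fin as Fin using (Fin)
open import Data.Bool using (Bool)
open import Data.List using (List; []; _∷_; map)
open import Data.Product using (Σ; _×_; _,_; proj₁; proj₂)
open import Data.Sum using (_⊎_; inj₁; inj₂; swap)
open import Data.Empty using (⊥-elim)
open import Relation.Nullary using (¬_; Dec; does; proof; yes; no; map′)
open import Relation.Nullary.Reflects using (Reflects; invert; ¬-reflects; _×-reflects_)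
open import Relation.Binary.Definitions using (DecidableEquality)
open import Relation.Binary.PropositionalEquality using (_≡_; _≢_; refl; sym; subst)
open import Relation.Binary.Structures using (IsPartialOrder; IsPreorder)
open import Data.List.Relation.Unary.All as All using (All; []; _∷_)
open import Data.List.Relation.Unary.All.Properties using (map⁻)
open import Data.List.Relation.Unary.AllPairs using ([]; _∷_)
open import Data.List.Relation.Unary.Unique.Propositional using (Unique)
open import Axiom.ExcludedMiddle using (ExcludedMiddle)
open import Axiom.DoubleNegationElimination using (DoubleNegationElimination; em⇒dne)

module _ {T : Set} {_⊴_ : T → T → Set} (⊴-refl : ∀ {x} → x ⊴ x) where

  maxChain-∋-comparable : ∀ {h y} → MaxChain _⊴_ h →
                          (∀ x → h x → (x ⊴ y) ⊎ (y ⊴ x)) → h y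
  maxChain-∋-comparable {h} {y} (chain , maximal) comparable =
    maximal (λ z → h z ⊎ z ≡ y) chain-with-y (λ _ → inj₁) y (inj₂ refl)
    where
      chain-with-y : Chain _⊴_ (λ z → h z ⊎ z ≡ y)
      chain-with-y x z (inj₁ hx) (inj₁ hz) = chain x z hx hz
      chain-with-y x _ (inj₁ hx) (inj₂ refl) = comparable x hx
      chain-with-y _ z (inj₂ refl) (inj₁ hz) = swap (comparable z hz)
      chain-with-y _ _ (inj₂ refl) (inj₂ refl) = inj₁ ⊴-refl

module Soundness {Ag : Set} (_≟_ : DecidableEquality Ag)
                 (em : ExcludedMiddle (lsuc 0ℓ)) where
  open J Ag

  dne : DoubleNegationElimination (lsuc 0ℓ)
  dne = em⇒dne em

  em₀ : {P : Set} → Dec P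
  em₀ = map′ Level.lower lift em

  ⇒-intro : {P Q : Set₁} → (P → Q) → ¬ (P × ¬ Q)
  ⇒-intro f (p , ¬q) = ¬q (f p)

  ⇒-elim : {P Q : Set₁} → ¬ (P × ¬ Q) → P → Q
  ⇒-elim i p = dne λ ¬q → i (p , ¬q)

  ∨-elim : {P Q : Set₁} → ¬ (¬ P × ¬ Q) → P ⊎ Q
  ∨-elim d = dne λ ¬p⊎q → d (¬p⊎q ∘ inj₁ , ¬p⊎q ∘ inj₂)

  agentBox : Ag × Form → Form
  agentBox (j , A) = [ j ] A

  module _ (M : Model) where

    History : Tree M → (Tree M → Set) → Set₁
    History = Hist (_⊴_ M)

    ⊴-refl : ∀ {x} → _⊴_ M x x
    ⊴-refl = IsPartialOrder.refl (⊴-po M)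

    ⊴-trans : ∀ {x y z} → _⊴_ M x y → _⊴_ M y z → _⊴_ M x z
    ⊴-trans = IsPartialOrder.trans (⊴-po M)

    R-refl : ∀ {x} → R M x x
    R-refl = IsPreorder.refl (R-pre M)

    R-trans : ∀ {x y z} → R M x y → R M y z → R M x z
    R-trans = IsPreorder.trans (R-pre M)

    Re-trans : ∀ {x y z} → Re M x y → Re M y z → Re M x z
    Re-trans = IsPreorder.trans (Re-pre M)

    valuation : Tree M → (Tree M → Set) → Form → Bool
    valuation m h A = does (em {M , m , h ⊨ A})

    evalB-reflects : ∀ m h A → Reflects (M , m , h ⊨ A) (evalB (valuation m h) A)
    evalB-reflects m h (A ∧ B)   = evalB-reflects m h A ×-reflects evalB-reflects m h B
    evalB-reflects m h (∼ A)     = ¬-reflects (evalB-reflects m h A)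
    evalB-reflects m h (var _)   = proof em
    evalB-reflects m h ([ _ ] _) = proof em
    evalB-reflects m h (□ _)     = proof em
    evalB-reflects m h (_ ∶ _)   = proof em
    evalB-reflects m h (K _)     = proof em
    evalB-reflects m h (E _)     = proof em

    tautology-true : ∀ m h {A} → Tautology A → M , m , h ⊨ A
    tautology-true m h {A} taut =
      invert (subst (Reflects _) (taut (valuation m h)) (evalB-reflects m h A))

    history-downward-closed : ∀ {m g y} → History m g → _⊴_ M y m → g y
    history-downward-closed {m} {g} {y} (maxg , g∋m) y⊴m =
      maxChain-∋-comparable ⊴-refl maxg comparable
      where
        comparable : ∀ x → g x → (_⊴_ M x y) ⊎ (_⊴_ M y x)
        comparable x gx with proj₁ maxg x m gx g∋m
        ... | inj₁ x⊴m = back-lin M m x y x⊴m y⊴m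
        ... | inj₂ m⊴x = inj₂ (⊴-trans y⊴m m⊴x)

    terminal-history-unique : ∀ {m h h'} → History m h →
      ¬ (Σ (Tree M) λ m' → Strict (_⊴_ M) m m' × h m') → History m h' → h ≐ h'
    terminal-history-unique {m} {h} {h'} (maxh , h∋m) no-successor H' =
      (λ x hx → history-downward-closed H' (below-m x hx)) ,
      (λ y h'y → maxChain-∋-comparable ⊴-refl maxh (comparable y h'y))
      where
        below-m : ∀ x → h x → _⊴_ M x m
        below-m x hx with proj₁ maxh x m hx h∋m
        ... | inj₁ x⊴m = x⊴m
        ... | inj₂ m⊴x with em₀ {x ≡ m}
        ...   | yes refl = ⊴-refl
        ...   | no x≢m = ⊥-elim (no-successor (x , (m⊴x , x≢m ∘ sym) , hx))
        comparable : ∀ y → h' y → ∀ x → h x → (_⊴_ M x y) ⊎ (_⊴_ M y x)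
        comparable y h'y x hx with proj₁ (proj₁ H') m y (proj₂ H') h'y
        ... | inj₁ m⊴y = inj₁ (⊴-trans (below-m x hx) m⊴y)
        ... | inj₂ y⊴m = back-lin M m x y (below-m x hx) y⊴m

    E-settled-later : ∀ {m h} → History m h →
      Σ (Tree M) λ m' → R M m m' × History m' h ×
        (∀ s → M , m , h ⊨ (E s) → M , m' , h ⊨ (□ E s))
    E-settled-later {m} {h} H@(maxh , _) with em₀ {Σ (Tree M) λ m' → Strict (_⊴_ M) m m' × h m'}
    ... | yes (m' , m◁m' , h∋m') =
      m' , ⊴⊆R M m m' (proj₁ m◁m') , (maxh , h∋m') , λ s (lift a) h' H' →
        let h'∋m = history-downward-closed H' (proj₁ m◁m')
        in lift (act-mono M m m' h' s m◁m' H'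
                   (act-nbc M m h h' m' s H (proj₁ H' , h'∋m) m◁m' h∋m' (proj₂ H') a))
    ... | no no-successor =
      m , R-refl , H , λ s (lift a) h' H' →
        lift (act-ext M m h h' s (terminal-history-unique H no-successor H') a)

    K-persistent : ∀ {m m' h h' A} → R M m m' → M , m , h ⊨ (K A) → M , m' , h' ⊨ (K A)
    K-persistent r ka m'' h'' r' H'' = ka m'' h'' (R-trans r r') H''

    Witness : Tree M → Form → Set₁
    Witness m B = Σ (Tree M → Set) λ g → History m g × M , m , g ⊨ B

    ◇-witness : ∀ {m h} B → M , m , h ⊨ (◇ B) → Witness m B
    ◇-witness B ◇B = dne λ none → ◇B λ g G b → none (g , G , b)

    []-cell-invariant : ∀ {m g g' j A} → History m g → History m g' →
                        Choice M m j g g' → M , m , g ⊨ ([ j ] A) → M , m , g' ⊨ ([ j ] A)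
    []-cell-invariant {m} {g} {g'} {j} G G' c box h' H' c' =
      box h' H' (ch-trans M m j g g' h' G G' H' c c')

    module _ {I : Set} {m : Tree M} {h : Tree M → Set} (F : I → Form) where

      ⊨⋀⇒All : ∀ i is → M , m , h ⊨ (⋀ (F i) (map F is)) → All (λ i → M , m , h ⊨ F i) (i ∷ is)
      ⊨⋀⇒All i []       a       = a ∷ []
      ⊨⋀⇒All i (i' ∷ is) (a , as) = a ∷ ⊨⋀⇒All i' is as

      All⇒⊨⋀ : ∀ i is → All (λ i → M , m , h ⊨ F i) (i ∷ is) → M , m , h ⊨ (⋀ (F i) (map F is))
      All⇒⊨⋀ i []        (a ∷ [])  = a
      All⇒⊨⋀ i (i' ∷ is) (a ∷ as) = a , All⇒⊨⋀ i' is as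

      ⊭⋁∼⇒All : ∀ i is → ¬ (M , m , h ⊨ (⋁ (∼ F i) (map (λ i → ∼ F i) is))) →
                All (λ i → M , m , h ⊨ F i) (i ∷ is)
      ⊭⋁∼⇒All i []        ¬d = dne ¬d ∷ []
      ⊭⋁∼⇒All i (i' ∷ is) ¬d with dne ¬d
      ... | ¬¬a , ¬rest = dne ¬¬a ∷ ⊭⋁∼⇒All i' is ¬rest

      All⇒⊭⋁∼ : ∀ i is → All (λ i → M , m , h ⊨ F i) (i ∷ is) →
                ¬ (M , m , h ⊨ (⋁ (∼ F i) (map (λ i → ∼ F i) is)))
      All⇒⊭⋁∼ i []        (a ∷ [])  ¬a        = ¬a a
      All⇒⊭⋁∼ i (i' ∷ is) (a ∷ as) ⋁ = ⋁ ((λ ¬a → ¬a a) , All⇒⊭⋁∼ i' is as)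

    module _ {m : Tree M} (default : Σ (Tree M → Set) (History m)) where

      profile : ∀ {ps} → All (Witness m ∘ agentBox) ps → Ag → Σ (Tree M → Set) (History m)
      profile [] j = default
      profile {(i , _) ∷ _} ((g , G , _) ∷ ws) j with i ≟ j
      ... | yes _ = g , G
      ... | no _  = profile ws j

      ChosenBy : ∀ {ps} → All (Witness m ∘ agentBox) ps → Ag × Form → Set₁
      ChosenBy ws q = M , m , proj₁ (profile ws (proj₁ q)) ⊨ agentBox q

      chosen-here : ∀ {i A ps} (w : Witness m ([ i ] A)) (ws : All (Witness m ∘ agentBox) ps) →
                    ChosenBy (w ∷ ws) (i , A)
      chosen-here {i} (_ , _ , w) ws with i ≟ i
      ... | yes _  = w
      ... | no i≢i = ⊥-elim (i≢i refl)

      chosen-there : ∀ {i A ps q} (w : Witness m ([ i ] A)) (ws : All (Witness m ∘ agentBox) ps) →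
                     i ≢ proj₁ q → ChosenBy ws q → ChosenBy (w ∷ ws) q
      chosen-there {i} {q = q} w ws i≢j chosen with i ≟ proj₁ q
      ... | yes i≡j = ⊥-elim (i≢j i≡j)
      ... | no _    = chosen

      profile-witnesses : ∀ {ps} (ws : All (Witness m ∘ agentBox) ps) →
                          Unique (map proj₁ ps) → All (ChosenBy ws) ps
      profile-witnesses []       []               = []
      profile-witnesses (w ∷ ws) (fresh ∷ unique) =
        chosen-here w ws ∷
        All.zipWith (λ (i≢j , chosen) → chosen-there w ws i≢j chosen)
                    (map⁻ fresh , profile-witnesses ws unique)

    A3-true : ∀ {m h} → History m h → ∀ j A js → Unique (map proj₁ ((j , A) ∷ js)) →
              M , m , h ⊨ (⋀ (◇ [ j ] A) (map (◇_ ∘ agentBox) js)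
                             ⇒ ◇ ⋀ ([ j ] A) (map agentBox js))
    A3-true {m} {h} H j A js unique = ⇒-intro λ ◇s □¬ →
      let ws = All.map (λ {q} → ◇-witness {h = h} (agentBox q)) (⊨⋀⇒All (◇_ ∘ agentBox) (j , A) js ◇s)
          pick = profile (h , H) ws
          h* , H* , h*-in-cells = indep M m (proj₁ ∘ pick) (proj₂ ∘ pick)
      in □¬ h* H* (All⇒⊨⋀ agentBox (j , A) js
           (All.map (λ {q} → []-cell-invariant (proj₂ (pick (proj₁ q))) H* (h*-in-cells (proj₁ q)))
                    (profile-witnesses (h , H) ws unique)))

    axiom-true : ∀ {A} → Axiom A → ∀ m h → History m h → M , m , h ⊨ A
    axiom-true (A0 taut) m h H = tautology-true m h taut
    axiom-true (A1□K A B) m h H = ⇒-intro λ □A⇒B → ⇒-intro λ □A h' H' → ⇒-elim (□A⇒B h' H') (□A h' H')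
    axiom-true (A1□T A) m h H = ⇒-intro λ □A → □A h H
    axiom-true (A1□4 A) m h H = ⇒-intro λ □A h' H' h'' H'' → □A h'' H''
    axiom-true (A1□B A) m h H = ⇒-intro λ a h' H' □¬A → □¬A h H a
    axiom-true (A1□5 A) m h H = ⇒-intro λ ◇A h' H' → ◇A
    axiom-true (A1jK j A B) m h H =
      ⇒-intro λ f → ⇒-intro λ g h' H' c → ⇒-elim (f h' H' c) (g h' H' c)
    axiom-true (A1jT j A) m h H = ⇒-intro λ f → f h H (ch-refl M m j h H)
    axiom-true (A1j4 j A) m h H =
      ⇒-intro λ f h' H' c h'' H'' c' → f h'' H'' (ch-trans M m j h h' h'' H H' H'' c c')
    axiom-true (A1jB j A) m h H =
      ⇒-intro λ a h' H' c ¬A → ¬A h H (ch-sym M m j h h' H H' c) a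
    axiom-true (A1j5 j A) m h H = ⇒-intro λ ◇A h' H' c □¬A →
      ◇A λ h'' H'' c'' → □¬A h'' H'' (ch-trans M m j h' h h'' H' H H'' (ch-sym M m j h h' H H' c) c'')
    axiom-true (A2 j A) m h H = ⇒-intro λ □A h' H' _ → □A h' H'
    axiom-true (A3 j A js unique) m h H = A3-true H j A js unique
    axiom-true (A4 s t A B) m h H = ⇒-intro λ { (lift e₁ , f₁) → ⇒-intro λ { (lift e₂ , f₂) →
      lift (𝓔-app M m s t A B e₁ e₂) , λ m' h' r H' → ⇒-elim (f₁ m' h' r H') (f₂ m' h' r H') } }
    axiom-true (A5 t A) m h H = ⇒-intro λ { (lift e , f) →
      (lift (𝓔-bang M m t A e) ,
        λ m' h' r H' → lift (𝓔-mono M m m' t A r e) , λ m'' h'' r' H'' → f m'' h'' (Re-trans r r') H'') ,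
      λ m' h' r H' → f m' h' (R⊆Re M m m' r) H' }
    axiom-true (A6 s t A) m h H = ⇒-intro λ s∨t → case (∨-elim s∨t)
      where
        case : (M , m , h ⊨ (s ∶ A)) ⊎ (M , m , h ⊨ (t ∶ A)) → M , m , h ⊨ ((s ⊕ t) ∶ A)
        case (inj₁ (lift e , f)) = lift (𝓔-sumˡ M m s t A e) , f
        case (inj₂ (lift e , f)) = lift (𝓔-sumʳ M m s t A e) , f
    axiom-true (A7K A B) m h H =
      ⇒-intro λ f → ⇒-intro λ g m' h' r H' → ⇒-elim (f m' h' r H') (g m' h' r H')
    axiom-true (A7T A) m h H = ⇒-intro λ KA → KA m h R-refl H
    axiom-true (A74 A) m h H = ⇒-intro λ KA m' h' r H' → K-persistent {h = h} {h' = h'} r KA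
    axiom-true (A8 A) m h H = ⇒-intro λ KA h' H' m' h'' r H'' h''' H''' → KA m' h''' r H'''
    axiom-true (A9 t) m h H = ⇒-intro λ □Et m' h' r H' h'' H'' →
      lift (act-Re M m m' t (R⊆Re M m m' r) (λ g G → Level.lower (□Et g G)) h'' H'')

    R4-sound : ∀ A t ts →
      (∀ m h → History m h → M , m , h ⊨ (K A ⇒ ⋁ (∼ □ E t) (map (λ s → ∼ □ E s) ts))) →
      ∀ m h → History m h → M , m , h ⊨ (K A ⇒ ⋁ (∼ E t) (map (λ s → ∼ E s) ts))
    R4-sound A t ts premise m h H with E-settled-later H
    ... | m' , m-R-m' , H' , settle = ⇒-intro λ KA → dne λ ¬⋁ →
      All⇒⊭⋁∼ (□_ ∘ E_) t ts (All.map (λ {s} → settle s) (⊭⋁∼⇒All E_ t ts ¬⋁))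
        (⇒-elim (premise m' h H') (K-persistent {h = h} {h' = h} m-R-m' KA))

  axiom-valid : ∀ A → Axiom A → Valid A
  axiom-valid A ax M _ = axiom-true M ax

  modus-ponens-valid : ∀ A B → Valid A → Valid (A ⇒ B) → Valid B
  modus-ponens-valid A B ⊨A ⊨A⇒B M N m h H = ⇒-elim (⊨A⇒B M N m h H) (⊨A M N m h H)

  necessitation-valid : ∀ A → Valid A → Valid (K A)
  necessitation-valid A ⊨A M N m h H m' h' _ H' = ⊨A M N m' h' H'

  constant-specification-valid : ∀ A (c : ℕ) → Axiom A → Valid (pconst c ∶ A)
  constant-specification-valid A c ax M normal m h H =
    lift (normal c m A ax) , λ m' h' _ H' → axiom-true M ax m' h' H'

  R4-valid : ∀ A t ts → Valid (K A ⇒ ⋁ (∼ □ E t) (map (λ s → ∼ □ E s) ts)) →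
             Valid (K A ⇒ ⋁ (∼ E t) (map (λ s → ∼ E s) ts))
  R4-valid A t ts premise M N = R4-sound M A t ts (premise M N)

theorem1 : (k : ℕ) → ExcludedMiddle (lsuc 0ℓ) →
    let open J (Fin (suc k)) in
      (∀ A → Axiom A → Valid A)
      × (∀ A B → Valid A → Valid (A ⇒ B) → Valid B)
      × (∀ A → Valid A → Valid (K A))
      × (∀ A (c : ℕ) → Axiom A → Valid (pconst c ∶ A))
      × (∀ A (t : Pol) (ts : List Pol) →
           Valid (K A ⇒ ⋁ (∼ □ E t) (map (λ s → ∼ □ E s) ts)) →
           Valid (K A ⇒ ⋁ (∼ E t) (map (λ s → ∼ E s) ts)))
theorem1 k em =
  axiom-valid , modus-ponens-valid , necessitation-valid , constant-specification-valid , R4-valid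
  where open Soundness Fin._≟_ em
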